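{- Let $G$ be a weak framework, without isolated vertices, for a connected matroid $M$. If $G$ has exactly two components and $e$ is an edge in a loop-component of $G$, then $M/e=M(G\setminus e)$, the cycle matroid of the graph obtained from $G$ by deleting $e$. Moreover, $M$ has a connected weak framework.
   Context: For a graph $G$ and a vertex $v$, $\mathrm{loops}_G(v)$ denotes the set of loop-edges of $G$ at $v$. Graphs are finite and may have loops and parallel edges. A graph $G$ is a weak framework for a matroid $M$ if (1) $E(G)=E(M)$; (2) $r_M(E(H))\le |V(H)|$ for each component $H$ of $G$; and (3) for each vertex $v$ of $G$, $\mathrm{cl}_M(E(G-v))\subseteq E(G-v)\cup \mathrm{loops}_G(v)$. A loop-component of a graph is a component consisting of exactly one vertex and exactly one edge. -}

module Defs where

open import Data.Nat using (ℕ; suc; _≤_; _<_; _∸_)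
open import Data.Fin using (Fin; punchIn)
open import Data.Fin.Subset using (Subset; _∈_; _∉_; _⊂_; _∪_; _-_; ⁅_⁆; ∣_∣; ⊤; outside)
open import Data.Vec using (insertAt)
open import Data.Product using (_×_; _,_; proj₁; proj₂; Σ; ∃; ∃-syntax)
open import Data.Sum using (_⊎_)
open import Relation.Nullary using (¬_)
open import Relation.Binary.PropositionalEquality using (_≡_; _≢_)
open import Relation.Binary.Construct.Closure.ReflexiveTransitive using (Star)
open import Function using (_⇔_)

record Matroid (m : ℕ) : Set where
  field
    rank        : Subset m → ℕ
    rank-bound  : ∀ X → rank X ≤ ∣ X ∣
    rank-mono   : ∀ X Y → X Data.Fin.Subset.⊆ Y → rank X ≤ rank Y
    rank-submod : ∀ X Y → rank (X ∪ Y) Data.Nat.+ rank (X Data.Fin.Subset.∩ Y)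
                          ≤ rank X Data.Nat.+ rank Y
open Matroid public

module _ {m : ℕ} (M : Matroid m) where

  Independent : Subset m → Set
  Independent X = rank M X ≡ ∣ X ∣

  InClosure : Subset m → Fin m → Set
  InClosure X f = rank M (X ∪ ⁅ f ⁆) ≡ rank M X

  Circuit : Subset m → Set
  Circuit C = (rank M C < ∣ C ∣) × (∀ Y → Y ⊂ C → Independent Y)

  ConnectedMatroid : Set
  ConnectedMatroid = ∀ e f → e ≢ f → ∃[ C ] (Circuit C × e ∈ C × f ∈ C)

-- The ground set E(M) - e is
-- identified with Fin k via punchIn e; a subset X of Fin k corresponds to
-- the subset  liftSubset e X  of Fin (suc k) (which avoids e).
liftSubset : {k : ℕ} → Fin (suc k) → Subset k → Subset (suc k)
liftSubset e X = insertAt X e outside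

contractRank : {k : ℕ} → Matroid (suc k) → Fin (suc k) → Subset k → ℕ
contractRank M e X = rank M (liftSubset e X ∪ ⁅ e ⁆) ∸ rank M ⁅ e ⁆

IndependentContract : {k : ℕ} → Matroid (suc k) → Fin (suc k) → Subset k → Set
IndependentContract M e X = contractRank M e X ≡ ∣ X ∣

-- Graphs (loops and parallel edges allowed): vertices Fin n, edges Fin m,
-- each edge has an (ordered) pair of ends; a loop has equal ends.

record Graph (n m : ℕ) : Set where
  field
    ends : Fin m → Fin n × Fin n
open Graph public

deleteEdge : {n k : ℕ} → Graph n (suc k) → Fin (suc k) → Graph n k
ends (deleteEdge G e) i = ends G (punchIn e i)

module _ {n m : ℕ} (G : Graph n m) where

  Incident : Fin n → Fin m → Set
  Incident v f = (proj₁ (ends G f) ≡ v) ⊎ (proj₂ (ends G f) ≡ v)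

  IsLoopAt : Fin n → Fin m → Set
  IsLoopAt v f = ends G f ≡ (v , v)

  AdjIn : Subset m → Fin n → Fin n → Set
  AdjIn X u v = ∃[ f ] (f ∈ X × ((ends G f ≡ (u , v)) ⊎ (ends G f ≡ (v , u))))

  ConnIn : Subset m → Fin n → Fin n → Set
  ConnIn X = Star (AdjIn X)

  Conn : Fin n → Fin n → Set
  Conn = ConnIn ⊤

  -- X is the edge set of a forest (contains no cycle): no edge of X has
  -- its ends joined by a walk in X - f.  (Loops and parallel pairs are cycles.)
  IsForest : Subset m → Set
  IsForest X = ∀ f → f ∈ X → ¬ ConnIn (X - f) (proj₁ (ends G f)) (proj₂ (ends G f))

  NoIsolatedVertices : Set
  NoIsolatedVertices = ∀ v → ∃[ f ] Incident v f

  ConnectedGraph : Set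
  ConnectedGraph = Fin n × (∀ u v → Conn u v)

  ExactlyTwoComponents : Set
  ExactlyTwoComponents =
    ∃[ a ] ∃[ b ] (¬ Conn a b × (∀ u → Conn a u ⊎ Conn b u))

  InLoopComponent : Fin m → Set
  InLoopComponent e =
    ∃[ v ] ((∀ u → Conn v u → u ≡ v) × Incident v e × (∀ f → Incident v f → f ≡ e))

  IsWeakFramework : Matroid m → Set
  IsWeakFramework M =
    -- (2) r_M(E(H)) ≤ |V(H)| for each component H (the component of v)
    (∀ v (C : Subset n) (X : Subset m) →
       (∀ u → (u ∈ C) ⇔ Conn v u) →
       (∀ f → (f ∈ X) ⇔ Conn v (proj₁ (ends G f))) →
       rank M X ≤ ∣ C ∣)
    ×
    -- (3) cl_M(E(G - v)) ⊆ E(G - v) ∪ loops_G(v)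
    (∀ v (X : Subset m) →
       (∀ f → (f ∈ X) ⇔ (¬ Incident v f)) →
       ∀ f → InClosure M X f → (f ∈ X) ⊎ IsLoopAt v f)

-- The loop e is alone at v, so every other edge lies in the second component H, and axiom (3)
-- makes M graphic from the inside: an edge at a vertex untouched by Z is not spanned by Z unless
-- it is a loop.  Growing a tree one pendant edge at a time therefore raises r(Z ∪ e) by one per
-- edge, so forests of G ∖ e are independent in M / e.  Conversely e shares a circuit with an edge
-- of H, whence r(M) = r(E - e) ≤ |V(H)| by (2); a cycle inside an independent set of M / e, spanned
-- by a tree and then extended to a spanning tree of H, would produce rank |V(H)| + 1.  Moving the
-- loop e from v onto a vertex of H keeps both axioms and makes the graph connected.
module Submission where

open import Defs
open import Data.Bool using (true; false)
open import Data.Empty using (⊥-elim)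
open import Data.Fin using (Fin; zero; suc; punchIn; punchOut)
open import Data.Fin.Properties using (any?; punchIn-punchOut; punchOut-punchIn; punchOut-cong; punchInᵢ≢i)
  renaming (_≟_ to _≟ᶠ_)
open import Data.Fin.Subset
open import Data.Fin.Subset.Properties
open import Data.Nat using (ℕ; zero; suc; _+_; _∸_; _≤_; _<_; z≤n; s≤s; s≤s⁻¹)
open import Data.Nat.Properties
open import Data.Product using (_×_; _,_; proj₁; proj₂; ∃; ∃-syntax; ∃₂)
open import Data.Sum using (_⊎_; inj₁; inj₂; [_,_]′; map; map₁; map₂; swap)
open import Data.Vec using (_∷_; []; here; there; insertAt; lookup; tabulate)
open import Data.Vec.Properties using (insertAt-punchIn; insertAt-lookup; []=⇒lookup; lookup⇒[]=; lookup∘tabulate)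
open import Function using (id; _∘_; _⇔_; mk⇔; Equivalence)
open import Relation.Binary.Construct.Closure.ReflexiveTransitive
  using (ε; _◅_; _◅◅_; gmap; fold; reverse; kleisliStar)
open import Relation.Binary.PropositionalEquality
open import Relation.Nullary using (¬_; Dec; yes; no; does)
open import Relation.Nullary.Decidable using (_×-dec_; _⊎-dec_; ¬?)
open import Relation.Unary using (Decidable)

∣p∪q∣≤∣p∣+∣q∣ : ∀ {n} (p q : Subset n) → ∣ p ∪ q ∣ ≤ ∣ p ∣ + ∣ q ∣
∣p∪q∣≤∣p∣+∣q∣ []            []            = z≤n
∣p∪q∣≤∣p∣+∣q∣ (true  ∷ p) (true  ∷ q) = s≤s (≤-trans (∣p∪q∣≤∣p∣+∣q∣ p q) (+-monoʳ-≤ ∣ p ∣ (n≤1+n _)))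
∣p∪q∣≤∣p∣+∣q∣ (true  ∷ p) (false ∷ q) = s≤s (∣p∪q∣≤∣p∣+∣q∣ p q)
∣p∪q∣≤∣p∣+∣q∣ (false ∷ p) (true  ∷ q) = ≤-trans (s≤s (∣p∪q∣≤∣p∣+∣q∣ p q)) (≤-reflexive (sym (+-suc _ _)))
∣p∪q∣≤∣p∣+∣q∣ (false ∷ p) (false ∷ q) = ∣p∪q∣≤∣p∣+∣q∣ p q

∣p∣≡∣p∩q∣+∣p─q∣ : ∀ {n} (p q : Subset n) → ∣ p ∣ ≡ ∣ p ∩ q ∣ + ∣ p ─ q ∣
∣p∣≡∣p∩q∣+∣p─q∣ []            []            = refl
∣p∣≡∣p∩q∣+∣p─q∣ (true  ∷ p) (true  ∷ q) = cong suc (∣p∣≡∣p∩q∣+∣p─q∣ p q)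
∣p∣≡∣p∩q∣+∣p─q∣ (true  ∷ p) (false ∷ q) = trans (cong suc (∣p∣≡∣p∩q∣+∣p─q∣ p q)) (sym (+-suc _ _))
∣p∣≡∣p∩q∣+∣p─q∣ (false ∷ p) (true  ∷ q) = ∣p∣≡∣p∩q∣+∣p─q∣ p q
∣p∣≡∣p∩q∣+∣p─q∣ (false ∷ p) (false ∷ q) = ∣p∣≡∣p∩q∣+∣p─q∣ p q

q⊆p⇒∣q∣+∣p─q∣≤∣p∣ : ∀ {n} {p q : Subset n} → q ⊆ p → ∣ q ∣ + ∣ p ─ q ∣ ≤ ∣ p ∣
q⊆p⇒∣q∣+∣p─q∣≤∣p∣ {p = p} {q} q⊆p = begin
  ∣ q ∣ + ∣ p ─ q ∣      ≤⟨ +-monoˡ-≤ _ (p⊆q⇒∣p∣≤∣q∣ (λ x∈q → x∈p∩q⁺ (q⊆p x∈q , x∈q))) ⟩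
  ∣ p ∩ q ∣ + ∣ p ─ q ∣  ≡⟨ sym (∣p∣≡∣p∩q∣+∣p─q∣ p q) ⟩
  ∣ p ∣                  ∎
  where open ≤-Reasoning

x∉p⇒∣p∪⁅x⁆∣≡1+∣p∣ : ∀ {n} {p : Subset n} {x} → x ∉ p → ∣ p ∪ ⁅ x ⁆ ∣ ≡ suc ∣ p ∣
x∉p⇒∣p∪⁅x⁆∣≡1+∣p∣ {p = p} {x} x∉p = ≤-antisym
  (≤-trans (∣p∪q∣≤∣p∣+∣q∣ p ⁅ x ⁆) (≤-reflexive (trans (cong (∣ p ∣ +_) (∣⁅x⁆∣≡1 x)) (+-comm _ 1))))
  (p⊂q⇒∣p∣<∣q∣ (p⊆p∪q ⁅ x ⁆ , x , q⊆p∪q p ⁅ x ⁆ (x∈⁅x⁆ x) , x∉p))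

x∉p⇒∣p∣<n : ∀ {n} {p : Subset n} {x} → x ∉ p → ∣ p ∣ < n
x∉p⇒∣p∣<n {n} {p} {x} x∉p = ≤-trans (p⊂q⇒∣p∣<∣q∣ (⊆⊤ , x , ∈⊤ , x∉p)) (≤-reflexive (∣⊤∣≡n n))

x∈p─q⇒x∉q : ∀ {n} {p q : Subset n} {x} → x ∈ p ─ q → x ∉ q
x∈p─q⇒x∉q {p = _ ∷ p} {true  ∷ q} ()        here
x∈p─q⇒x∉q {p = _ ∷ p} {true  ∷ q} (there x∈) (there x∈q) = x∈p─q⇒x∉q {p = p} {q} x∈ x∈q
x∈p─q⇒x∉q {p = _ ∷ p} {false ∷ q} (there x∈) (there x∈q) = x∈p─q⇒x∉q {p = p} {q} x∈ x∈q

x∈p-y⇒x≢y : ∀ {n} {p : Subset n} {x y} → x ∈ p - y → x ≢ y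
x∈p-y⇒x≢y {y = y} x∈ refl = x∈p─q⇒x∉q x∈ (x∈⁅x⁆ y)

x∈p∪⁅y⁆⁻ : ∀ {n} {p : Subset n} {x y} → x ∈ p ∪ ⁅ y ⁆ → x ∈ p ⊎ x ≡ y
x∈p∪⁅y⁆⁻ {p = p} {y = y} x∈ = map₂ (x∈⁅y⁆⇒x≡y y) (x∈p∪q⁻ p ⁅ y ⁆ x∈)

p⊆p-x∪⁅x⁆ : ∀ {n} {p : Subset n} {x} → p ⊆ (p - x) ∪ ⁅ x ⁆
p⊆p-x∪⁅x⁆ {p = p} {x} {y} y∈ with y ≟ᶠ x
... | yes refl = q⊆p∪q (p - y) ⁅ y ⁆ (x∈⁅x⁆ y)
... | no y≢x   = p⊆p∪q ⁅ x ⁆ (x∈p∧x≢y⇒x∈p-y y∈ y≢x)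

x∈p⇒⁅x⁆⊆p : ∀ {n} {p : Subset n} {x} → x ∈ p → ⁅ x ⁆ ⊆ p
x∈p⇒⁅x⁆⊆p {p = p} {x} x∈p y∈ = subst (_∈ p) (sym (x∈⁅y⁆⇒x≡y x y∈)) x∈p

x∈p⇒p-x∪⁅x⁆⊆p : ∀ {n} {p : Subset n} {x} → x ∈ p → (p - x) ∪ ⁅ x ⁆ ⊆ p
x∈p⇒p-x∪⁅x⁆⊆p {p = p} {x} x∈p y∈ = [ p─q⊆p p ⁅ x ⁆ , x∈p⇒⁅x⁆⊆p x∈p ]′ (x∈p∪q⁻ (p - x) ⁅ x ⁆ y∈)

x∈⊤-y⇔x≢y : ∀ {n} {x y : Fin n} → x ∈ ⊤ - y ⇔ x ≢ y
x∈⊤-y⇔x≢y = mk⇔ x∈p-y⇒x≢y (x∈p∧x≢y⇒x∈p-y ∈⊤)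

[p∪q]∪r≡[p∪r]∪q : ∀ {n} (p q r : Subset n) → (p ∪ q) ∪ r ≡ (p ∪ r) ∪ q
[p∪q]∪r≡[p∪r]∪q p q r = trans (∪-assoc p q r) (trans (cong (p ∪_) (∪-comm q r)) (sym (∪-assoc p r q)))

m∸n≡o⇔m≡n+o : ∀ {m n o} → n ≤ m → m ∸ n ≡ o ⇔ m ≡ n + o
m∸n≡o⇔m≡n+o {m} {n} n≤m = mk⇔ (λ eq → trans (sym (m+[n∸m]≡n n≤m)) (cong (n +_) eq))
                                 (λ eq → trans (cong (_∸ n) eq) (m+n∸m≡n n _))

subsetOf : ∀ {n} {P : Fin n → Set} → Decidable P → Subset n
subsetOf P? = tabulate (λ x → does (P? x))

∈-subsetOf : ∀ {n} {P : Fin n → Set} (P? : Decidable P) {x} → x ∈ subsetOf P? ⇔ P x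
∈-subsetOf {P = P} P? {x} = mk⇔ to from
  where
  to : x ∈ subsetOf P? → P x
  to x∈ with P? x | trans (sym (lookup∘tabulate (λ y → does (P? y)) x)) ([]=⇒lookup x∈)
  ... | yes px | _ = px
  from : P x → x ∈ subsetOf P?
  from px with P? x in eq
  ... | yes _ = lookup⇒[]= x _ (trans (lookup∘tabulate (λ y → does (P? y)) x) (cong does eq))
  ... | no ¬px = ⊥-elim (¬px px)

module _ {k : ℕ} (e : Fin (suc k)) where

  punchIn-∈-liftSubset : ∀ {Y : Subset k} {i} → i ∈ Y → punchIn e i ∈ liftSubset e Y
  punchIn-∈-liftSubset {Y} {i} i∈ = lookup⇒[]= _ _ (trans (insertAt-punchIn Y e false i) ([]=⇒lookup i∈))

  ∉-liftSubset : ∀ {Y : Subset k} → e ∉ liftSubset e Y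
  ∉-liftSubset {Y} e∈ with trans (sym (insertAt-lookup Y e false)) ([]=⇒lookup e∈)
  ... | ()

  ∈-liftSubset⁻ : ∀ {Y : Subset k} {x} → x ∈ liftSubset e Y → ∃[ i ] (x ≡ punchIn e i × i ∈ Y)
  ∈-liftSubset⁻ {Y} {x} x∈ with e ≟ᶠ x
  ... | yes refl = ⊥-elim (∉-liftSubset x∈)
  ... | no e≢x = punchOut e≢x , sym (punchIn-punchOut e≢x) ,
    lookup⇒[]= _ _ (begin
      lookup Y (punchOut e≢x)                                    ≡⟨ insertAt-punchIn Y e false (punchOut e≢x) ⟨
      lookup (insertAt Y e false) (punchIn e (punchOut e≢x))    ≡⟨ cong (lookup (insertAt Y e false)) (punchIn-punchOut e≢x) ⟩
      lookup (insertAt Y e false) x                              ≡⟨ []=⇒lookup x∈ ⟩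
      true                                                       ∎)
    where open ≡-Reasoning

  liftSubset-mono : ∀ {A B : Subset k} → A ⊆ B → liftSubset e A ⊆ liftSubset e B
  liftSubset-mono A⊆B x∈ with ∈-liftSubset⁻ x∈
  ... | i , refl , i∈ = punchIn-∈-liftSubset (A⊆B i∈)

∣liftSubset∣ : ∀ {k} (e : Fin (suc k)) (Y : Subset k) → ∣ liftSubset e Y ∣ ≡ ∣ Y ∣
∣liftSubset∣ zero    Y             = refl
∣liftSubset∣ (suc e) (true  ∷ Y) = cong suc (∣liftSubset∣ e Y)
∣liftSubset∣ (suc e) (false ∷ Y) = ∣liftSubset∣ e Y

liftSubset-∪ : ∀ {k} (e : Fin (suc k)) (A B : Subset k) →
               liftSubset e (A ∪ B) ≡ liftSubset e A ∪ liftSubset e B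
liftSubset-∪ zero    A       B       = refl
liftSubset-∪ (suc e) (a ∷ A) (b ∷ B) = cong (_ ∷_) (liftSubset-∪ e A B)

liftSubset-⊥ : ∀ {k} (e : Fin (suc k)) → liftSubset e ⊥ ≡ ⊥
liftSubset-⊥ zero                = refl
liftSubset-⊥ {suc k} (suc e) = cong (false ∷_) (liftSubset-⊥ e)

liftSubset-⁅⁆ : ∀ {k} (e : Fin (suc k)) (i : Fin k) → liftSubset e ⁅ i ⁆ ≡ ⁅ punchIn e i ⁆
liftSubset-⁅⁆ zero    i       = refl
liftSubset-⁅⁆ (suc e) zero    = cong (true ∷_) (liftSubset-⊥ e)
liftSubset-⁅⁆ (suc e) (suc i) = cong (false ∷_) (liftSubset-⁅⁆ e i)

module _ {m : ℕ} (M : Matroid m) where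

  rank-cong : ∀ {A B} → A ⊆ B → B ⊆ A → rank M A ≡ rank M B
  rank-cong {A} {B} A⊆B B⊆A = ≤-antisym (rank-mono M A B A⊆B) (rank-mono M B A B⊆A)

  rank-∪-≤ : ∀ A B → rank M (A ∪ B) ≤ rank M A + rank M B
  rank-∪-≤ A B = ≤-trans (m≤m+n _ _) (rank-submod M A B)

  rank-∪⁅⁆-≤ : ∀ A f → rank M (A ∪ ⁅ f ⁆) ≤ suc (rank M A)
  rank-∪⁅⁆-≤ A f = begin
    rank M (A ∪ ⁅ f ⁆)          ≤⟨ rank-∪-≤ A ⁅ f ⁆ ⟩
    rank M A + rank M ⁅ f ⁆     ≤⟨ +-monoʳ-≤ (rank M A) (rank-bound M ⁅ f ⁆) ⟩
    rank M A + ∣ ⁅ f ⁆ ∣        ≡⟨ cong (rank M A +_) (∣⁅x⁆∣≡1 f) ⟩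
    rank M A + 1                ≡⟨ +-comm _ 1 ⟩
    suc (rank M A)              ∎
    where open ≤-Reasoning

  InClosure-mono : ∀ {A B f} → A ⊆ B → InClosure M A f → InClosure M B f
  InClosure-mono {A} {B} {f} A⊆B f∈clA =
    ≤-antisym (+-cancelʳ-≤ (rank M A) _ _ submod) (rank-mono M _ _ (p⊆p∪q ⁅ f ⁆))
    where
    open ≤-Reasoning
    submod : rank M (B ∪ ⁅ f ⁆) + rank M A ≤ rank M B + rank M A
    submod = begin
      rank M (B ∪ ⁅ f ⁆) + rank M A
        ≤⟨ +-mono-≤ (rank-mono M _ _ λ x∈ → [ q⊆p∪q _ B , p⊆p∪q B ∘ q⊆p∪q A ⁅ f ⁆ ]′ (x∈p∪q⁻ B ⁅ f ⁆ x∈))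
                    (rank-mono M _ _ λ x∈ → x∈p∩q⁺ (p⊆p∪q ⁅ f ⁆ x∈ , A⊆B x∈)) ⟩
      rank M ((A ∪ ⁅ f ⁆) ∪ B) + rank M ((A ∪ ⁅ f ⁆) ∩ B)
        ≤⟨ rank-submod M (A ∪ ⁅ f ⁆) B ⟩
      rank M (A ∪ ⁅ f ⁆) + rank M B
        ≡⟨ cong (_+ rank M B) f∈clA ⟩
      rank M A + rank M B
        ≡⟨ +-comm (rank M A) _ ⟩
      rank M B + rank M A ∎

  Independent-⊆ : ∀ {A B} → Independent M A → B ⊆ A → Independent M B
  Independent-⊆ {A} {B} indA B⊆A = ≤-antisym (rank-bound M B) (+-cancelʳ-≤ ∣ A ─ B ∣ _ _ (begin
    ∣ B ∣ + ∣ A ─ B ∣             ≤⟨ q⊆p⇒∣q∣+∣p─q∣≤∣p∣ B⊆A ⟩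
    ∣ A ∣                         ≡⟨ indA ⟨
    rank M A                      ≤⟨ rank-mono M A (B ∪ (A ─ B)) split ⟩
    rank M (B ∪ (A ─ B))          ≤⟨ rank-∪-≤ B (A ─ B) ⟩
    rank M B + rank M (A ─ B)     ≤⟨ +-monoʳ-≤ (rank M B) (rank-bound M (A ─ B)) ⟩
    rank M B + ∣ A ─ B ∣          ∎))
    where
    open ≤-Reasoning
    split : A ⊆ B ∪ (A ─ B)
    split {x} x∈A with x ∈? B
    ... | yes x∈B = p⊆p∪q _ x∈B
    ... | no  x∉B = q⊆p∪q B _ (x∈p∧x∉q⇒x∈p─q x∈A x∉B)

  module _ {C : Subset m} (circuit : Circuit M C) where

    Circuit⇒InClosure : ∀ {f} → f ∈ C → InClosure M (C - f) f
    Circuit⇒InClosure {f} f∈C = ≤-antisym (s≤s⁻¹ (begin-strict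
      rank M ((C - f) ∪ ⁅ f ⁆)   ≡⟨ rank-cong (x∈p⇒p-x∪⁅x⁆⊆p f∈C) p⊆p-x∪⁅x⁆ ⟩
      rank M C                   <⟨ proj₁ circuit ⟩
      ∣ C ∣                      ≤⟨ p⊆q⇒∣p∣≤∣q∣ (p⊆p-x∪⁅x⁆ {p = C} {f}) ⟩
      ∣ (C - f) ∪ ⁅ f ⁆ ∣        ≡⟨ x∉p⇒∣p∪⁅x⁆∣≡1+∣p∣ {p = C - f} (λ f∈ → x∈p-y⇒x≢y f∈ refl) ⟩
      suc ∣ C - f ∣              ≡⟨ cong suc (proj₂ circuit (C - f) (x∈p⇒p-x⊂p f∈C)) ⟨
      suc (rank M (C - f))       ∎))
      (rank-mono M _ _ (p⊆p∪q ⁅ f ⁆))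
      where open ≤-Reasoning

    Circuit⇒rank⁅⁆≡1 : ∀ {f g} → f ∈ C → g ∈ C → g ≢ f → rank M ⁅ f ⁆ ≡ 1
    Circuit⇒rank⁅⁆≡1 {f} {g} f∈C g∈C g≢f =
      trans (proj₂ circuit ⁅ f ⁆ (x∈p⇒⁅x⁆⊆p f∈C , g , g∈C , x≢y⇒x∉⁅y⁆ g≢f)) (∣⁅x⁆∣≡1 f)

module _ {n m : ℕ} (G : Graph n m) where

  Joins : Fin m → Fin n → Fin n → Set
  Joins f x y = (ends G f ≡ (x , y)) ⊎ (ends G f ≡ (y , x))

  Joins-sym : ∀ {f x y} → Joins f x y → Joins f y x
  Joins-sym = swap

  Joins⇒Incident : ∀ {f x y} → Joins f x y → Incident G x f
  Joins⇒Incident (inj₁ eq) = inj₁ (cong proj₁ eq)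
  Joins⇒Incident (inj₂ eq) = inj₂ (cong proj₂ eq)

  Incident-Joins : ∀ {f x y z} → Joins f x y → Incident G z f → z ≡ x ⊎ z ≡ y
  Incident-Joins (inj₁ eq) (inj₁ refl) = inj₁ (cong proj₁ eq)
  Incident-Joins (inj₁ eq) (inj₂ refl) = inj₂ (cong proj₂ eq)
  Incident-Joins (inj₂ eq) (inj₁ refl) = inj₂ (cong proj₁ eq)
  Incident-Joins (inj₂ eq) (inj₂ refl) = inj₁ (cong proj₂ eq)

  IsLoopAt-Joins : ∀ {f x y z} → IsLoopAt G z f → Joins f x y → x ≡ y
  IsLoopAt-Joins loop (inj₁ eq) with trans (sym eq) loop
  ... | refl = refl
  IsLoopAt-Joins loop (inj₂ eq) with trans (sym eq) loop
  ... | refl = refl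

  incident? : ∀ x f → Dec (Incident G x f)
  incident? x f = (proj₁ (ends G f) ≟ᶠ x) ⊎-dec (proj₂ (ends G f) ≟ᶠ x)

  ConnIn-sym : ∀ {X x y} → ConnIn G X x y → ConnIn G X y x
  ConnIn-sym = reverse (λ (f , f∈ , j) → f , f∈ , Joins-sym j)

  ConnIn-mono : ∀ {X Y} → X ⊆ Y → ∀ {x y} → ConnIn G X x y → ConnIn G Y x y
  ConnIn-mono X⊆Y = gmap id (λ (f , f∈ , j) → f , X⊆Y f∈ , j)

  Closed : Subset m → Subset n → Set
  Closed Y W = ∀ {x y} → AdjIn G Y x y → x ∈ W → y ∈ W

  Closed-ConnIn : ∀ {Y W} → Closed Y W → ∀ {x y} → ConnIn G Y x y → x ∈ W → y ∈ W
  Closed-ConnIn {W = W} closed = fold (λ x y → x ∈ W → y ∈ W) (λ adj reach → reach ∘ closed adj) (λ x∈ → x∈)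

  Closed-Incident : ∀ {Y W f x} → Closed Y W → f ∈ Y → Incident G x f → x ∈ W →
                    proj₁ (ends G f) ∈ W × proj₂ (ends G f) ∈ W
  Closed-Incident closed f∈ (inj₁ refl) x∈ = x∈ , closed (_ , f∈ , inj₁ refl) x∈
  Closed-Incident closed f∈ (inj₂ refl) x∈ = closed (_ , f∈ , inj₂ refl) x∈ , x∈

  IsForest-⊆ : ∀ {X Y} → IsForest G X → Y ⊆ X → IsForest G Y
  IsForest-⊆ forest Y⊆X f f∈Y cycle =
    forest f (Y⊆X f∈Y) (ConnIn-mono (λ g∈ → x∈p∧x≢y⇒x∈p-y (Y⊆X (p─q⊆p _ _ g∈)) (x∈p-y⇒x≢y g∈)) cycle)

  data Grown (Y : Subset m) (W₀ : Subset n) : Subset m → Subset n → Set where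
    seed   : Grown Y W₀ ⊥ W₀
    sprout : ∀ {T W g w x} → Grown Y W₀ T W → g ∈ Y → Joins g w x → w ∈ W → x ∉ W →
             Grown Y W₀ (T ∪ ⁅ g ⁆) (W ∪ ⁅ x ⁆)

  module _ {Y : Subset m} {W₀ : Subset n} where

    Grown-⊆ : ∀ {T W} → Grown Y W₀ T W → T ⊆ Y
    Grown-⊆ seed                         = ⊥-elim ∘ ∉⊥
    Grown-⊆ (sprout grown g∈ _ _ _) h∈ with x∈p∪⁅y⁆⁻ h∈
    ... | inj₁ h∈T  = Grown-⊆ grown h∈T
    ... | inj₂ refl = g∈

    Grown-⊇ : ∀ {T W} → Grown Y W₀ T W → W₀ ⊆ W
    Grown-⊇ seed                        = λ x∈ → x∈
    Grown-⊇ (sprout grown _ _ _ _) x∈ = p⊆p∪q _ (Grown-⊇ grown x∈)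

    Grown-Incident : ∀ {T W g x} → Grown Y W₀ T W → g ∈ T → Incident G x g → x ∈ W
    Grown-Incident seed g∈ _ = ⊥-elim (∉⊥ g∈)
    Grown-Incident (sprout {x = x} grown _ joins w∈ _) h∈ inc with x∈p∪⁅y⁆⁻ h∈
    ... | inj₁ h∈T  = p⊆p∪q ⁅ x ⁆ (Grown-Incident grown h∈T inc)
    ... | inj₂ refl with Incident-Joins joins inc
    ...   | inj₁ refl = p⊆p∪q ⁅ x ⁆ w∈
    ...   | inj₂ refl = q⊆p∪q _ ⁅ x ⁆ (x∈⁅x⁆ x)

    Grown-fresh : ∀ {T W g w x} → Grown Y W₀ T W → Joins g w x → x ∉ W → g ∉ T
    Grown-fresh grown joins x∉ g∈T = x∉ (Grown-Incident grown g∈T (Joins⇒Incident (Joins-sym joins)))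

    Grown-card : ∀ {T W} → Grown Y W₀ T W → ∣ W ∣ ≡ ∣ W₀ ∣ + ∣ T ∣
    Grown-card seed = sym (trans (cong (∣ W₀ ∣ +_) (∣⊥∣≡0 m)) (+-identityʳ _))
    Grown-card (sprout {T} {W} {g} {_} {x} grown _ joins _ x∉) = begin
      ∣ W ∪ ⁅ x ⁆ ∣              ≡⟨ x∉p⇒∣p∪⁅x⁆∣≡1+∣p∣ x∉ ⟩
      suc ∣ W ∣                  ≡⟨ cong suc (Grown-card grown) ⟩
      suc (∣ W₀ ∣ + ∣ T ∣)       ≡⟨ +-suc _ _ ⟨
      ∣ W₀ ∣ + suc ∣ T ∣         ≡⟨ cong (∣ W₀ ∣ +_) (x∉p⇒∣p∪⁅x⁆∣≡1+∣p∣ (Grown-fresh grown joins x∉)) ⟨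
      ∣ W₀ ∣ + ∣ T ∪ ⁅ g ⁆ ∣     ∎
      where open ≡-Reasoning

    Grown-reaches : ∀ {T W x} → Grown Y W₀ T W → x ∈ W → ∃[ w ] (w ∈ W₀ × ConnIn G T w x)
    Grown-reaches seed x∈ = _ , x∈ , ε
    Grown-reaches (sprout {g = g} grown _ joins w∈ _) y∈ with x∈p∪⁅y⁆⁻ y∈
    ... | inj₁ y∈W  = let (w₀ , w₀∈ , path) = Grown-reaches grown y∈W in
                      w₀ , w₀∈ , ConnIn-mono (p⊆p∪q ⁅ g ⁆) path
    ... | inj₂ refl = let (w₀ , w₀∈ , path) = Grown-reaches grown w∈ in
                      w₀ , w₀∈ , ConnIn-mono (p⊆p∪q ⁅ g ⁆) path ◅◅ ((g , q⊆p∪q _ ⁅ g ⁆ (x∈⁅x⁆ g) , joins) ◅ ε)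

  Leaving : Subset m → Subset n → Fin m → Set
  Leaving Y W g = g ∈ Y × ((proj₁ (ends G g) ∈ W × proj₂ (ends G g) ∉ W) ⊎ (proj₂ (ends G g) ∈ W × proj₁ (ends G g) ∉ W))

  leaving? : ∀ Y W → Decidable (Leaving Y W)
  leaving? Y W g = (g ∈? Y) ×-dec (((_ ∈? W) ×-dec ¬? (_ ∈? W)) ⊎-dec ((_ ∈? W) ×-dec ¬? (_ ∈? W)))

  ¬Leaving⇒Closed : ∀ {Y W} → ¬ ∃ (Leaving Y W) → Closed Y W
  ¬Leaving⇒Closed {Y} {W} none {y = y} (g , g∈ , joins) x∈ with y ∈? W
  ... | yes y∈ = y∈
  ... | no  y∉ with joins
  ...   | inj₁ refl = ⊥-elim (none (g , g∈ , inj₁ (x∈ , y∉)))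
  ...   | inj₂ refl = ⊥-elim (none (g , g∈ , inj₂ (x∈ , y∉)))

  Leaving⇒Joins : ∀ {Y W g} → Leaving Y W g → ∃₂ λ w x → Joins g w x × w ∈ W × x ∉ W
  Leaving⇒Joins (_ , inj₁ (w∈ , x∉)) = _ , _ , inj₁ refl , w∈ , x∉
  Leaving⇒Joins (_ , inj₂ (w∈ , x∉)) = _ , _ , inj₂ refl , w∈ , x∉

  module _ (Y : Subset m) (W₀ : Subset n) where

    grow-from : ∀ d {T W} → Grown Y W₀ T W → n ≤ ∣ W ∣ + d → ∃₂ λ T′ W′ → Grown Y W₀ T′ W′ × Closed Y W′
    grow-from d {T} {W} grown n≤ with any? (leaving? Y W)
    ... | no none = T , W , grown , ¬Leaving⇒Closed none
    ... | yes (g , leaving) with Leaving⇒Joins leaving | d | n≤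
    ...   | (_ , _ , _ , _ , x∉) | zero | n≤W =
            ⊥-elim (<⇒≱ (x∉p⇒∣p∣<n x∉) (≤-trans n≤W (≤-reflexive (+-identityʳ _))))
    ...   | (w , x , joins , w∈ , x∉) | suc d′ | n≤W =
            grow-from d′ (sprout grown (proj₁ leaving) joins w∈ x∉) (begin
              n                     ≤⟨ n≤W ⟩
              ∣ W ∣ + suc d′        ≡⟨ +-suc _ _ ⟩
              suc ∣ W ∣ + d′        ≡⟨ cong (_+ d′) (x∉p⇒∣p∪⁅x⁆∣≡1+∣p∣ x∉) ⟨
              ∣ W ∪ ⁅ x ⁆ ∣ + d′    ∎)
      where open ≤-Reasoning

    grow : ∃₂ λ T W → Grown Y W₀ T W × Closed Y W
    grow = grow-from n seed (m≤n+m n ∣ W₀ ∣)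

  Grown-reaches-root : ∀ {Y a T W x} → Grown Y ⁅ a ⁆ T W → x ∈ W → ConnIn G T a x
  Grown-reaches-root grown x∈ with Grown-reaches grown x∈
  ... | w , w∈ , path rewrite x∈⁅y⁆⇒x≡y _ w∈ = path

  Grown-forest-complete : ∀ {X a T W h x} → IsForest G X → Grown X ⁅ a ⁆ T W → Closed X W →
                          h ∈ X → Incident G x h → x ∈ W → h ∈ T
  Grown-forest-complete {X} {T = T} {h = h} forest grown closed h∈X inc x∈ with h ∈? T
  ... | yes h∈T = h∈T
  ... | no  h∉T with Closed-Incident closed h∈X inc x∈
  ...   | end₁∈ , end₂∈ = ⊥-elim (forest h h∈X (ConnIn-mono T⊆X-h
            (ConnIn-sym (Grown-reaches-root grown end₁∈) ◅◅ Grown-reaches-root grown end₂∈)))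
    where
    T⊆X-h : T ⊆ X - h
    T⊆X-h g∈ = x∈p∧x≢y⇒x∈p-y (Grown-⊆ grown g∈) (λ { refl → h∉T g∈ })

-- ρ stands for a shifted rank function that behaves like that of the cycle matroid of G.
module GraphicRank {n m : ℕ} (G : Graph n m) (ρ : Subset m → ℕ)
  (ρ-mono : ∀ {A B} → A ⊆ B → ρ A ≤ ρ B)
  (ρ-pendant : ∀ {Z u f} → (∀ {g} → g ∈ Z → ¬ Incident G u g) → Incident G u f → ¬ IsLoopAt G u f →
               ρ (Z ∪ ⁅ f ⁆) ≡ suc (ρ Z)) where

  Tight : Subset m → Set
  Tight X = ρ X ≡ ρ ⊥ + ∣ X ∣

  Grown-rank : ∀ {Y W₀ T W S} → Grown G Y W₀ T W →
               (∀ {h x} → h ∈ S → Incident G x h → x ∈ W → x ∈ W₀) → ρ S + ∣ T ∣ ≤ ρ (S ∪ T)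
  Grown-rank {S = S} seed _ = begin
    ρ S + ∣ ⊥ {m} ∣   ≡⟨ cong (ρ S +_) (∣⊥∣≡0 m) ⟩
    ρ S + 0           ≡⟨ +-identityʳ _ ⟩
    ρ S               ≡⟨ cong ρ (∪-identityʳ S) ⟨
    ρ (S ∪ ⊥)         ∎
    where open ≤-Reasoning
  Grown-rank {S = S} (sprout {T} {W} {g} {w} {x} grown g∈ joins w∈ x∉) S-avoids = begin
    ρ S + ∣ T ∪ ⁅ g ⁆ ∣         ≡⟨ cong (ρ S +_) (x∉p⇒∣p∪⁅x⁆∣≡1+∣p∣ (Grown-fresh G grown joins x∉)) ⟩
    ρ S + suc ∣ T ∣             ≡⟨ +-suc _ _ ⟩
    suc (ρ S + ∣ T ∣)           ≤⟨ s≤s (Grown-rank grown λ h∈ inc x∈ → S-avoids h∈ inc (p⊆p∪q _ x∈)) ⟩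
    suc (ρ (S ∪ T))             ≡⟨ ρ-pendant S∪T-avoids-x (Joins⇒Incident G (Joins-sym G joins)) g-nonloop ⟨
    ρ ((S ∪ T) ∪ ⁅ g ⁆)         ≡⟨ cong ρ (∪-assoc S T ⁅ g ⁆) ⟩
    ρ (S ∪ (T ∪ ⁅ g ⁆))         ∎
    where
    open ≤-Reasoning
    x∈W∪x : x ∈ W ∪ ⁅ x ⁆
    x∈W∪x = q⊆p∪q W ⁅ x ⁆ (x∈⁅x⁆ x)
    S∪T-avoids-x : ∀ {h} → h ∈ S ∪ T → ¬ Incident G x h
    S∪T-avoids-x h∈ inc with x∈p∪q⁻ S T h∈
    ... | inj₁ h∈S = x∉ (Grown-⊇ G grown (S-avoids h∈S inc x∈W∪x))
    ... | inj₂ h∈T = x∉ (Grown-Incident G grown h∈T inc)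
    g-nonloop : ¬ IsLoopAt G x g
    g-nonloop loop with IsLoopAt-Joins G loop joins
    ... | refl = x∉ w∈

  -- Strong induction on ∣ X ∣: grow the tree T of the component of one edge, then recurse on X ─ T.
  IsForest-rank-< : ∀ d X → ∣ X ∣ < d → IsForest G X → ρ ⊥ + ∣ X ∣ ≤ ρ X
  IsForest-rank-< zero    X ()    _
  IsForest-rank-< (suc d) X |X|≤d forest with nonempty? X
  ... | no empty rewrite Empty-unique empty = ≤-reflexive (trans (cong (ρ ⊥ +_) (∣⊥∣≡0 m)) (+-identityʳ _))
  ... | yes (f , f∈X) with grow G X ⁅ proj₁ (ends G f) ⁆
  ...   | T , W , grown , closed = begin
    ρ ⊥ + ∣ X ∣                  ≤⟨ +-monoʳ-≤ (ρ ⊥) |X|≤|X─T|+|T| ⟩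
    ρ ⊥ + (∣ X ─ T ∣ + ∣ T ∣)    ≡⟨ +-assoc (ρ ⊥) _ _ ⟨
    ρ ⊥ + ∣ X ─ T ∣ + ∣ T ∣      ≤⟨ +-monoˡ-≤ ∣ T ∣ (IsForest-rank-< d (X ─ T) smaller rest-forest) ⟩
    ρ (X ─ T) + ∣ T ∣            ≤⟨ Grown-rank grown rest-avoids-W ⟩
    ρ ((X ─ T) ∪ T)              ≤⟨ ρ-mono (λ h∈ → [ p─q⊆p X T , Grown-⊆ G grown ]′ (x∈p∪q⁻ _ T h∈)) ⟩
    ρ X                          ∎
    where
    open ≤-Reasoning
    complete : ∀ {h x} → h ∈ X → Incident G x h → x ∈ W → h ∈ T
    complete = Grown-forest-complete G forest grown closed
    f∈T : f ∈ T
    f∈T = complete f∈X (inj₁ refl) (Grown-⊇ G grown (x∈⁅x⁆ _))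
    rest-forest : IsForest G (X ─ T)
    rest-forest = IsForest-⊆ G forest (p─q⊆p X T)
    rest-avoids-W : ∀ {h x} → h ∈ X ─ T → Incident G x h → x ∈ W → x ∈ ⁅ proj₁ (ends G f) ⁆
    rest-avoids-W h∈ inc x∈ = ⊥-elim (x∈p─q⇒x∉q h∈ (complete (p─q⊆p X T h∈) inc x∈))
    smaller : ∣ X ─ T ∣ < d
    smaller = <-≤-trans (p∩q≢∅⇒∣p─q∣<∣p∣ X T (f , x∈p∩q⁺ (f∈X , f∈T))) (s≤s⁻¹ |X|≤d)
    |X|≤|X─T|+|T| : ∣ X ∣ ≤ ∣ X ─ T ∣ + ∣ T ∣
    |X|≤|X─T|+|T| = begin
      ∣ X ∣                   ≡⟨ ∣p∣≡∣p∩q∣+∣p─q∣ X T ⟩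
      ∣ X ∩ T ∣ + ∣ X ─ T ∣   ≤⟨ +-monoˡ-≤ _ (∣p∩q∣≤∣q∣ X T) ⟩
      ∣ T ∣ + ∣ X ─ T ∣       ≡⟨ +-comm ∣ T ∣ _ ⟩
      ∣ X ─ T ∣ + ∣ T ∣       ∎

  IsForest-rank : ∀ {X} → IsForest G X → ρ ⊥ + ∣ X ∣ ≤ ρ X
  IsForest-rank {X} = IsForest-rank-< (suc ∣ X ∣) X ≤-refl

  module _ (Tight-⊆ : ∀ {A B} → Tight A → B ⊆ A → Tight B)
           {C : Subset n} (ρ⊤<ρ⊥+∣C∣ : ρ ⊤ < ρ ⊥ + ∣ C ∣)
           (reaches-C : ∀ f {c} → c ∈ C → Conn G (proj₁ (ends G f)) c) where

    -- A cycle through f is spanned by a tree T₁ plus f; extending T₁ ∪ {f} by a tree T₂ that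
    -- reaches all of C gives a set whose rank exceeds what C can carry.
    Tight⇒IsForest : ∀ {X} → Tight X → IsForest G X
    Tight⇒IsForest {X} tight f f∈X cycle with grow G (X - f) ⁅ proj₁ (ends G f) ⁆
    ... | T₁ , W₁ , grown₁ , closed₁ with grow G ⊤ W₁
    ...   | T₂ , W₂ , grown₂ , closed₂ = <-irrefl refl (begin-strict
      ρ ⊥ + ∣ W₂ ∣                  ≡⟨ cong (ρ ⊥ +_) (Grown-card G grown₂) ⟩
      ρ ⊥ + (∣ W₁ ∣ + ∣ T₂ ∣)       ≡⟨ +-assoc (ρ ⊥) _ _ ⟨
      ρ ⊥ + ∣ W₁ ∣ + ∣ T₂ ∣         ≡⟨ cong (_+ ∣ T₂ ∣) ρS≡ρ⊥+∣W₁∣ ⟨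
      ρ S + ∣ T₂ ∣                  ≤⟨ Grown-rank grown₂ S-inside-W₁ ⟩
      ρ (S ∪ T₂)                    ≤⟨ ρ-mono ⊆⊤ ⟩
      ρ ⊤                           <⟨ ρ⊤<ρ⊥+∣C∣ ⟩
      ρ ⊥ + ∣ C ∣                   ≤⟨ +-monoʳ-≤ (ρ ⊥) (p⊆q⇒∣p∣≤∣q∣ C⊆W₂) ⟩
      ρ ⊥ + ∣ W₂ ∣                  ∎)
      where
      open ≤-Reasoning
      a : Fin n
      a = proj₁ (ends G f)
      a∈W₁ : a ∈ W₁
      a∈W₁ = Grown-⊇ G grown₁ (x∈⁅x⁆ _)
      b∈W₁ : proj₂ (ends G f) ∈ W₁
      b∈W₁ = Closed-ConnIn G closed₁ cycle a∈W₁
      S : Subset m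
      S = T₁ ∪ ⁅ f ⁆
      f∉T₁ : f ∉ T₁
      f∉T₁ f∈T₁ = x∈p-y⇒x≢y (Grown-⊆ G grown₁ f∈T₁) refl
      S⊆X : S ⊆ X
      S⊆X h∈ = [ p─q⊆p X _ ∘ Grown-⊆ G grown₁ , (λ { refl → f∈X }) ]′ (x∈p∪⁅y⁆⁻ h∈)
      ρS≡ρ⊥+∣W₁∣ : ρ S ≡ ρ ⊥ + ∣ W₁ ∣
      ρS≡ρ⊥+∣W₁∣ = begin-equality
        ρ S                        ≡⟨ Tight-⊆ tight S⊆X ⟩
        ρ ⊥ + ∣ S ∣                ≡⟨ cong (ρ ⊥ +_) (x∉p⇒∣p∪⁅x⁆∣≡1+∣p∣ f∉T₁) ⟩
        ρ ⊥ + suc ∣ T₁ ∣           ≡⟨ cong (λ k → ρ ⊥ + (k + ∣ T₁ ∣)) (∣⁅x⁆∣≡1 a) ⟨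
        ρ ⊥ + (∣ ⁅ a ⁆ ∣ + ∣ T₁ ∣)  ≡⟨ cong (ρ ⊥ +_) (Grown-card G grown₁) ⟨
        ρ ⊥ + ∣ W₁ ∣               ∎
      S-inside-W₁ : ∀ {h x} → h ∈ S → Incident G x h → x ∈ W₂ → x ∈ W₁
      S-inside-W₁ h∈ inc _ with x∈p∪⁅y⁆⁻ h∈
      ... | inj₁ h∈T₁ = Grown-Incident G grown₁ h∈T₁ inc
      ... | inj₂ refl = [ (λ { refl → a∈W₁ }) , (λ { refl → b∈W₁ }) ]′ inc
      C⊆W₂ : C ⊆ W₂
      C⊆W₂ c∈ = Closed-ConnIn G closed₂ (reaches-C f c∈) (Grown-⊇ G grown₂ a∈W₁)

module _ {n m : ℕ} {G : Graph n m} {M : Matroid m} (framework : IsWeakFramework G M) where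

  WeakFramework-closure : ∀ {Z u f} → (∀ {g} → g ∈ Z → ¬ Incident G u g) → InClosure M Z f →
                          ¬ Incident G u f ⊎ IsLoopAt G u f
  WeakFramework-closure {Z} {u} {f} Z-avoids f∈clZ =
    map₁ (Equivalence.to ∈-avoiding)
      (proj₂ framework u avoiding (λ _ → ∈-avoiding) f (InClosure-mono M (Equivalence.from ∈-avoiding ∘ Z-avoids) f∈clZ))
    where
    avoiding : Subset m
    avoiding = subsetOf (λ g → ¬? (incident? G u g))
    ∈-avoiding : ∀ {g} → g ∈ avoiding ⇔ (¬ Incident G u g)
    ∈-avoiding = ∈-subsetOf (λ g → ¬? (incident? G u g))

  WeakFramework-pendant : ∀ {Z u f} → (∀ {g} → g ∈ Z → ¬ Incident G u g) → Incident G u f →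
                          ¬ IsLoopAt G u f → rank M (Z ∪ ⁅ f ⁆) ≡ suc (rank M Z)
  WeakFramework-pendant {Z} {u} {f} Z-avoids inc nonloop =
    ≤-antisym (rank-∪⁅⁆-≤ M Z f) (≤∧≢⇒< (rank-mono M _ _ (p⊆p∪q ⁅ f ⁆)) (f∉clZ ∘ sym))
    where
    f∉clZ : ¬ InClosure M Z f
    f∉clZ f∈clZ = [ (λ ¬inc → ¬inc inc) , nonloop ]′ (WeakFramework-closure Z-avoids f∈clZ)

Conn-deleteLoop : ∀ {n k} {G : Graph n (suc k)} {e u} → IsLoopAt G u e →
                  ∀ {x y} → Conn G x y → Conn (deleteEdge G e) x y
Conn-deleteLoop {G = G} {e} loop = kleisliStar id step
  where
  step : ∀ {x y} → AdjIn G ⊤ x y → Conn (deleteEdge G e) x y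
  step {x} (g , _ , joins) with e ≟ᶠ g
  ... | yes refl = subst (Conn (deleteEdge G e) x) (IsLoopAt-Joins G loop joins) ε
  ... | no e≢g   = (punchOut e≢g , ∈⊤ , subst (λ h → Joins G h _ _) (sym (punchIn-punchOut e≢g)) joins) ◅ ε

mapVertices : ∀ {n n′ m} → (Fin n → Fin n′) → Graph n m → Graph n′ m
ends (mapVertices s G) f = s (proj₁ (ends G f)) , s (proj₂ (ends G f))

module _ {n n′ m : ℕ} (s : Fin n → Fin n′) (G : Graph n m) where

  Joins-mapVertices : ∀ {f x y} → Joins G f x y → Joins (mapVertices s G) f (s x) (s y)
  Joins-mapVertices = map (cong (λ (x , y) → s x , s y)) (cong (λ (x , y) → s x , s y))

  Conn-mapVertices : ∀ {x y} → Conn G x y → Conn (mapVertices s G) (s x) (s y)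
  Conn-mapVertices = gmap s (λ (f , f∈ , joins) → f , f∈ , Joins-mapVertices joins)

  Incident-mapVertices : ∀ {x f} → Incident G x f → Incident (mapVertices s G) (s x) f
  Incident-mapVertices = map (cong s) (cong s)

  Incident-mapVertices⁻ : ∀ {x′ f} → Incident (mapVertices s G) x′ f → ∃[ x ] (Incident G x f × s x ≡ x′)
  Incident-mapVertices⁻ (inj₁ eq) = _ , inj₁ refl , eq
  Incident-mapVertices⁻ (inj₂ eq) = _ , inj₂ refl , eq

  IsLoopAt-mapVertices : ∀ {x f} → IsLoopAt G x f → IsLoopAt (mapVertices s G) (s x) f
  IsLoopAt-mapVertices loop = cong (λ (x , y) → s x , s y) loop

collapse : ∀ {n} → Fin (suc n) → Fin n → Fin (suc n) → Fin n
collapse v t x with v ≟ᶠ x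
... | yes _   = t
... | no v≢x  = punchOut v≢x

module _ {n : ℕ} (v : Fin (suc n)) (t : Fin n) where

  collapse-punchIn : ∀ y → collapse v t (punchIn v y) ≡ y
  collapse-punchIn y with v ≟ᶠ punchIn v y
  ... | yes v≡ = ⊥-elim (punchInᵢ≢i v y (sym v≡))
  ... | no  v≢ = trans (punchOut-cong v refl) (punchOut-punchIn v)

  collapse-fiber : ∀ {x y} → collapse v t y ≡ x → y ≡ v ⊎ y ≡ punchIn v x
  collapse-fiber {y = y} eq with v ≟ᶠ y
  ... | yes v≡y = inj₁ (sym v≡y)
  ... | no  v≢y = inj₂ (trans (sym (punchIn-punchOut v≢y)) (cong (punchIn v) eq))

module LoopComponent {n m : ℕ} (G : Graph n m) {e : Fin m} (loopComponent : InLoopComponent G e) where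

  v : Fin n
  v = proj₁ loopComponent

  Conn-v⇒≡v : ∀ {u} → Conn G v u → u ≡ v
  Conn-v⇒≡v = proj₁ (proj₂ loopComponent) _

  Incident-v⇒≡e : ∀ {g} → Incident G v g → g ≡ e
  Incident-v⇒≡e = proj₂ (proj₂ (proj₂ loopComponent)) _

  Incident-≢e⇒≢v : ∀ {g u} → g ≢ e → Incident G u g → u ≢ v
  Incident-≢e⇒≢v g≢e inc refl = g≢e (Incident-v⇒≡e inc)

  e-loop : IsLoopAt G v e
  e-loop with proj₁ (proj₂ (proj₂ loopComponent))
  ... | inj₁ end₁≡v = cong₂ _,_ end₁≡v (Conn-v⇒≡v ((e , ∈⊤ , inj₁ (cong (_, _) end₁≡v)) ◅ ε))
  ... | inj₂ end₂≡v = cong₂ _,_ (Conn-v⇒≡v ((e , ∈⊤ , inj₂ (cong (_ ,_) end₂≡v)) ◅ ε)) end₂≡v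

  Incident-e⇒≡v : ∀ {u} → Incident G u e → u ≡ v
  Incident-e⇒≡v (inj₁ refl) = cong proj₁ e-loop
  Incident-e⇒≡v (inj₂ refl) = cong proj₂ e-loop

  OtherComponent : Set
  OtherComponent = ∃[ w ] (w ≢ v × ∀ u → u ≢ v → Conn G w u)

  otherComponent-beside : ∀ {a b} → ¬ Conn G a b → (∀ u → Conn G a u ⊎ Conn G b u) → Conn G a v → OtherComponent
  otherComponent-beside {b = b} ¬a~b cover a~v with Conn-v⇒≡v (ConnIn-sym G a~v)
  ... | refl = b , (λ { refl → ¬a~b ε }) , λ u u≢v →
                 [ (λ v~u → ⊥-elim (u≢v (Conn-v⇒≡v v~u))) , (λ b~u → b~u) ]′ (cover u)

  otherComponent : ExactlyTwoComponents G → OtherComponent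
  otherComponent (a , b , ¬a~b , cover) with cover v
  ... | inj₁ a~v = otherComponent-beside ¬a~b cover a~v
  ... | inj₂ b~v = otherComponent-beside (¬a~b ∘ ConnIn-sym G) (swap ∘ cover) b~v

  module OtherSide (other : OtherComponent) where

    w : Fin n
    w = proj₁ other

    w≢v : w ≢ v
    w≢v = proj₁ (proj₂ other)

    Conn-w : ∀ {u} → u ≢ v → Conn G w u
    Conn-w = proj₂ (proj₂ other) _

    Conn-w⇒≢v : ∀ {u} → Conn G w u → u ≢ v
    Conn-w⇒≢v w~u refl = w≢v (Conn-v⇒≡v (ConnIn-sym G w~u))

    Conn-≢v : ∀ {x y} → x ≢ v → y ≢ v → Conn G x y
    Conn-≢v x≢v y≢v = ConnIn-sym G (Conn-w x≢v) ◅◅ Conn-w y≢v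

    module Rank {M : Matroid m} (framework : IsWeakFramework G M)
                (noIsolated : NoIsolatedVertices G) (connected : ConnectedMatroid M) where

      rank-⊤-e≤∣⊤-v∣ : rank M (⊤ - e) ≤ ∣ ⊤ - v ∣
      rank-⊤-e≤∣⊤-v∣ = proj₁ framework w (⊤ - v) (⊤ - e) (λ _ → vertex⇔) (λ _ → edge⇔)
        where
        vertex⇔ : ∀ {u} → u ∈ ⊤ - v ⇔ Conn G w u
        vertex⇔ = mk⇔ (Conn-w ∘ Equivalence.to x∈⊤-y⇔x≢y)
                      (Equivalence.from x∈⊤-y⇔x≢y ∘ Conn-w⇒≢v)
        edge⇔ : ∀ {f} → f ∈ ⊤ - e ⇔ Conn G w (proj₁ (ends G f))
        edge⇔ = mk⇔ (λ f∈ → Conn-w (Incident-≢e⇒≢v (x∈p-y⇒x≢y f∈) (inj₁ refl)))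
                    (λ w~end → x∈p∧x≢y⇒x∈p-y ∈⊤ λ { refl → Conn-w⇒≢v w~end (Incident-e⇒≡v (inj₁ refl)) })

      f₀ : Fin m
      f₀ = proj₁ (noIsolated w)

      f₀≢e : f₀ ≢ e
      f₀≢e f₀≡e = Conn-w⇒≢v ε (Incident-e⇒≡v (subst (Incident G w) f₀≡e (proj₂ (noIsolated w))))

      circuit : ∃[ C ] (Circuit M C × e ∈ C × f₀ ∈ C)
      circuit = connected e f₀ (f₀≢e ∘ sym)

      rank⁅e⁆≡1 : rank M ⁅ e ⁆ ≡ 1
      rank⁅e⁆≡1 = let (_ , isCircuit , e∈C , f₀∈C) = circuit in Circuit⇒rank⁅⁆≡1 M isCircuit e∈C f₀∈C f₀≢e

      rank⊤≤∣⊤-v∣ : rank M ⊤ ≤ ∣ ⊤ - v ∣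
      rank⊤≤∣⊤-v∣ = let (C , isCircuit , e∈C , _) = circuit in begin
        rank M ⊤                   ≤⟨ rank-mono M _ _ p⊆p-x∪⁅x⁆ ⟩
        rank M ((⊤ - e) ∪ ⁅ e ⁆)   ≡⟨ InClosure-mono M (x∈p∧x≢y⇒x∈p-y ∈⊤ ∘ x∈p-y⇒x≢y)
                                                     (Circuit⇒InClosure M isCircuit e∈C) ⟩
        rank M (⊤ - e)             ≤⟨ rank-⊤-e≤∣⊤-v∣ ⟩
        ∣ ⊤ - v ∣                  ∎
        where open ≤-Reasoning

module Contraction {n k : ℕ} {G : Graph n (suc k)} {M : Matroid (suc k)} {e : Fin (suc k)}
  (loopComponent : InLoopComponent G e) (other : LoopComponent.OtherComponent G loopComponent)
  (framework : IsWeakFramework G M) (noIsolated : NoIsolatedVertices G) (connected : ConnectedMatroid M) where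

  open LoopComponent G loopComponent
  open OtherSide other
  open Rank {M} framework noIsolated connected

  D : Graph n k
  D = deleteEdge G e

  -- r_{M/e} = ρ - ρ ⊥
  ρ : Subset k → ℕ
  ρ Y = rank M (liftSubset e Y ∪ ⁅ e ⁆)

  ρ-mono : ∀ {A B} → A ⊆ B → ρ A ≤ ρ B
  ρ-mono A⊆B = rank-mono M _ _ λ x∈ → [ p⊆p∪q _ ∘ liftSubset-mono e A⊆B , q⊆p∪q _ _ ]′ (x∈p∪q⁻ _ _ x∈)

  ρ⊥≡1 : ρ ⊥ ≡ 1
  ρ⊥≡1 = begin
    rank M (liftSubset e ⊥ ∪ ⁅ e ⁆)   ≡⟨ cong (λ Z → rank M (Z ∪ ⁅ e ⁆)) (liftSubset-⊥ e) ⟩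
    rank M (⊥ ∪ ⁅ e ⁆)                ≡⟨ cong (rank M) (∪-identityˡ ⁅ e ⁆) ⟩
    rank M ⁅ e ⁆                      ≡⟨ rank⁅e⁆≡1 ⟩
    1                                 ∎
    where open ≡-Reasoning

  ∣liftSubset∪e∣ : ∀ Y → ∣ liftSubset e Y ∪ ⁅ e ⁆ ∣ ≡ ρ ⊥ + ∣ Y ∣
  ∣liftSubset∪e∣ Y = begin
    ∣ liftSubset e Y ∪ ⁅ e ⁆ ∣   ≡⟨ x∉p⇒∣p∪⁅x⁆∣≡1+∣p∣ (∉-liftSubset e) ⟩
    suc ∣ liftSubset e Y ∣       ≡⟨ cong suc (∣liftSubset∣ e Y) ⟩
    1 + ∣ Y ∣                    ≡⟨ cong (_+ ∣ Y ∣) ρ⊥≡1 ⟨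
    ρ ⊥ + ∣ Y ∣                  ∎
    where open ≡-Reasoning

  ρ-pendant : ∀ {Z u f} → (∀ {g} → g ∈ Z → ¬ Incident D u g) → Incident D u f → ¬ IsLoopAt D u f →
              ρ (Z ∪ ⁅ f ⁆) ≡ suc (ρ Z)
  ρ-pendant {Z} {u} {f} Z-avoids inc nonloop = begin
    rank M (liftSubset e (Z ∪ ⁅ f ⁆) ∪ ⁅ e ⁆)      ≡⟨ cong (λ L → rank M (L ∪ ⁅ e ⁆)) (liftSubset-∪ e Z ⁅ f ⁆) ⟩
    rank M ((liftSubset e Z ∪ liftSubset e ⁅ f ⁆) ∪ ⁅ e ⁆)
      ≡⟨ cong (λ F → rank M ((liftSubset e Z ∪ F) ∪ ⁅ e ⁆)) (liftSubset-⁅⁆ e f) ⟩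
    rank M ((liftSubset e Z ∪ ⁅ punchIn e f ⁆) ∪ ⁅ e ⁆)
      ≡⟨ cong (rank M) ([p∪q]∪r≡[p∪r]∪q _ _ _) ⟩
    rank M ((liftSubset e Z ∪ ⁅ e ⁆) ∪ ⁅ punchIn e f ⁆)
      ≡⟨ WeakFramework-pendant {G = G} {M} framework Z′-avoids inc nonloop ⟩
    suc (ρ Z)                                     ∎
    where
    open ≡-Reasoning
    Z′-avoids : ∀ {g} → g ∈ liftSubset e Z ∪ ⁅ e ⁆ → ¬ Incident G u g
    Z′-avoids g∈ with x∈p∪⁅y⁆⁻ g∈
    ... | inj₂ refl = Incident-≢e⇒≢v (punchInᵢ≢i e f) inc ∘ Incident-e⇒≡v
    ... | inj₁ g∈L with ∈-liftSubset⁻ e g∈L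
    ...   | _ , refl , i∈Z = Z-avoids i∈Z

  open GraphicRank D ρ ρ-mono ρ-pendant

  Tight⇔Independent : ∀ {Y} → Tight Y ⇔ Independent M (liftSubset e Y ∪ ⁅ e ⁆)
  Tight⇔Independent {Y} = mk⇔ (λ tight → trans tight (sym (∣liftSubset∪e∣ Y)))
                               (λ indep → trans indep (∣liftSubset∪e∣ Y))

  Tight-⊆ : ∀ {A B} → Tight A → B ⊆ A → Tight B
  Tight-⊆ tight B⊆A = Equivalence.from Tight⇔Independent (Independent-⊆ M (Equivalence.to Tight⇔Independent tight)
    λ x∈ → [ p⊆p∪q _ ∘ liftSubset-mono e B⊆A , q⊆p∪q _ _ ]′ (x∈p∪q⁻ _ _ x∈))

  ρ⊤<ρ⊥+∣⊤-v∣ : ρ ⊤ < ρ ⊥ + ∣ ⊤ - v ∣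
  ρ⊤<ρ⊥+∣⊤-v∣ = begin-strict
    ρ ⊤             ≤⟨ rank-mono M _ _ ⊆⊤ ⟩
    rank M ⊤        ≤⟨ rank⊤≤∣⊤-v∣ ⟩
    ∣ ⊤ - v ∣       <⟨ n<1+n _ ⟩
    1 + ∣ ⊤ - v ∣   ≡⟨ cong (_+ ∣ ⊤ - v ∣) ρ⊥≡1 ⟨
    ρ ⊥ + ∣ ⊤ - v ∣ ∎
    where open ≤-Reasoning

  reaches-⊤-v : ∀ f {c} → c ∈ ⊤ - v → Conn D (proj₁ (ends D f)) c
  reaches-⊤-v f c∈ = Conn-deleteLoop e-loop
    (Conn-≢v (Incident-≢e⇒≢v (punchInᵢ≢i e f) (inj₁ refl)) (x∈p-y⇒x≢y c∈))

  IndependentContract⇔Tight : ∀ {X} → IndependentContract M e X ⇔ Tight X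
  IndependentContract⇔Tight {X} =
    subst (λ r → (ρ X ∸ r ≡ ∣ X ∣) ⇔ Tight X) (trans ρ⊥≡1 (sym (rank⁅e⁆≡1)))
          (m∸n≡o⇔m≡n+o (ρ-mono (⊥-elim ∘ ∉⊥)))

  IndependentContract⇔IsForest : ∀ X → IndependentContract M e X ⇔ IsForest D X
  IndependentContract⇔IsForest X = mk⇔
    (Tight⇒IsForest Tight-⊆ ρ⊤<ρ⊥+∣⊤-v∣ reaches-⊤-v ∘ Equivalence.to IndependentContract⇔Tight)
    (λ forest → Equivalence.from IndependentContract⇔Tight
       (≤-antisym (≤-trans (rank-bound M _) (≤-reflexive (∣liftSubset∪e∣ X))) (IsForest-rank forest)))

module Relocation {n m : ℕ} {G : Graph (suc n) m} {M : Matroid m} {e : Fin m}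
  (loopComponent : InLoopComponent G e) (other : LoopComponent.OtherComponent G loopComponent)
  (framework : IsWeakFramework G M) (noIsolated : NoIsolatedVertices G) (connected : ConnectedMatroid M) where

  open LoopComponent G loopComponent
  open OtherSide other
  open Rank {M} framework noIsolated connected

  target : Fin n
  target = punchOut (w≢v ∘ sym)

  squash : Fin (suc n) → Fin n
  squash = collapse v target

  -- G with the vertex v merged into the other component, so that e becomes a loop there
  G′ : Graph n m
  G′ = mapVertices squash G

  G′-connected : ConnectedGraph G′
  G′-connected = target , λ x y → subst₂ (Conn G′) (collapse-punchIn v target x) (collapse-punchIn v target y)
    (Conn-mapVertices squash G (Conn-≢v (punchInᵢ≢i v x) (punchInᵢ≢i v y)))

  G′-rank-bound : ∀ x (C : Subset n) (X : Subset m) → (∀ u → (u ∈ C) ⇔ Conn G′ x u) → rank M X ≤ ∣ C ∣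
  G′-rank-bound x C X C⇔ = begin
    rank M X      ≤⟨ rank-mono M _ _ ⊆⊤ ⟩
    rank M ⊤      ≤⟨ rank⊤≤∣⊤-v∣ ⟩
    ∣ ⊤ - v ∣     ≤⟨ s≤s⁻¹ (<-≤-trans (x∈p⇒∣p-x∣<∣p∣ {p = ⊤} (∈⊤ {x = v})) (≤-reflexive (∣⊤∣≡n (suc n)))) ⟩
    n             ≡⟨ ∣⊤∣≡n n ⟨
    ∣ ⊤ {n} ∣     ≤⟨ p⊆q⇒∣p∣≤∣q∣ {p = ⊤} (λ {u} _ → Equivalence.from (C⇔ u) (proj₂ G′-connected x u)) ⟩
    ∣ C ∣         ∎
    where open ≤-Reasoning

  avoids-G′⇒avoids-G : ∀ {x X g} → (g ∈ X → ¬ Incident G′ x g) → g ∈ X → ¬ Incident G (punchIn v x) g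
  avoids-G′⇒avoids-G {x} {g = g} avoids g∈X incG =
    avoids g∈X (subst (λ y → Incident G′ y g) (collapse-punchIn v target x) (Incident-mapVertices squash G incG))

  G′-closure : ∀ x (X : Subset m) → (∀ f → (f ∈ X) ⇔ (¬ Incident G′ x f)) →
               ∀ f → InClosure M X f → (f ∈ X) ⊎ IsLoopAt G′ x f
  G′-closure x X X⇔ f f∈clX with f ∈? X
  ... | yes f∈X = inj₁ f∈X
  ... | no  f∉X with incident? G′ x f
  ...   | no ¬inc = ⊥-elim (f∉X (Equivalence.from (X⇔ f) ¬inc))
  ...   | yes inc with WeakFramework-closure {G = G} {M} framework (avoids-G′⇒avoids-G (Equivalence.to (X⇔ _))) f∈clX
  ...     | inj₂ loop  =
              inj₂ (subst (λ y → IsLoopAt G′ y f) (collapse-punchIn v target x) (IsLoopAt-mapVertices squash G loop))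
  ...     | inj₁ ¬incG with Incident-mapVertices⁻ squash G inc
  ...       | y , incG , squash-y≡x with collapse-fiber v target squash-y≡x
  ...         | inj₂ refl = ⊥-elim (¬incG incG)
  ...         | inj₁ refl rewrite Incident-v⇒≡e incG =
                  inj₂ (subst (λ y → IsLoopAt G′ y e) squash-y≡x (IsLoopAt-mapVertices squash G e-loop))

  G′-framework : IsWeakFramework G′ M
  G′-framework = (λ x C X C⇔ _ → G′-rank-bound x C X C⇔) , G′-closure

lemma3p6 : {n k : ℕ} (G : Graph n (suc k)) (M : Matroid (suc k)) →
    IsWeakFramework G M → NoIsolatedVertices G → ConnectedMatroid M →
    ExactlyTwoComponents G → (e : Fin (suc k)) → InLoopComponent G e →
    ((X : Subset k) → IndependentContract M e X ⇔ IsForest (deleteEdge G e) X)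
    × (∃[ n′ ] ∃[ G′ ] (IsWeakFramework {n′} {suc k} G′ M × ConnectedGraph G′))
lemma3p6 {zero}  G M framework noIsolated connected twoComponents e (() , _)
lemma3p6 {suc n} G M framework noIsolated connected twoComponents e loopComponent =
  Contraction.IndependentContract⇔IsForest {M = M} loopComponent other framework noIsolated connected ,
  (n , G′ , G′-framework , G′-connected)
  where
  other : LoopComponent.OtherComponent G loopComponent
  other = LoopComponent.otherComponent G loopComponent twoComponents
  open Relocation {M = M} loopComponent other framework noIsolated connected
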